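{- Let $i,d$ be positive integers and $t \in [id,(i+1)d)$ an integer. Suppose that for some prime $p\leq i$, every element of the connected component of $pd$ in the divisor graph of $\{pd,pd+1,\ldots,pt\}$ is divisible by $p$. Then $r(pd,pt)=r(d,t)$, and moreover $r(p^jd,p^jt)=r(d,t)$ for all $j>0$.
   Context: The divisor graph of a set $S$ of positive integers has vertex set $S$, with two distinct elements joined by an edge if one divides the other. A set of positive integers is primitive if no element divides another element. For integers $k\le n$, $r(k,n)$ is the number of primitive subsets of $\{k,k+1,\ldots,n\}$ divided by the number of primitive subsets of $\{k+1,\ldots,n\}$. -}

module Defs where

open import Data.Nat using (ℕ; zero; suc; _+_; _*_; _∸_; _≤_)
open import Data.Nat.Divisibility using (_∣_; _∣?_)
open import Data.List using (List; []; _∷_; map; _++_; upTo; length; filter)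
open import Data.List.Relation.Unary.AllPairs using (AllPairs; allPairs?)
open import Data.Integer using (+_)
open import Data.Rational using (ℚ; _/_)
open import Data.Product using (_×_)
open import Data.Sum using (_⊎_)
open import Relation.Nullary using (¬_; Dec)
open import Relation.Nullary.Decidable using (¬?; _×-dec_)
open import Relation.Binary.PropositionalEquality using (_≡_)

-- the interval {k, k+1, ..., n} as a duplicate-free increasing list (empty if n < k)
interval : ℕ → ℕ → List ℕ
interval k n = map (λ x → k + x) (upTo (suc n ∸ k))

-- all sub-lists (= all subsets, since the input list has no duplicates)
sublists : List ℕ → List (List ℕ)
sublists [] = [] ∷ []
sublists (x ∷ xs) = sublists xs ++ map (x ∷_) (sublists xs)

Incomparable : ℕ → ℕ → Set
Incomparable a b = ¬ (a ∣ b) × ¬ (b ∣ a)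

incomparable? : (a b : ℕ) → Dec (Incomparable a b)
incomparable? a b = ¬? (a ∣? b) ×-dec ¬? (b ∣? a)

Primitive : List ℕ → Set
Primitive = AllPairs Incomparable

primitive? : (S : List ℕ) → Dec (Primitive S)
primitive? = allPairs? incomparable?

numPrimitive : ℕ → ℕ → ℕ
numPrimitive k n = length (filter primitive? (sublists (interval k n)))

-- r(k,n) = #primitive subsets of {k..n} / #primitive subsets of {k+1..n}.
-- The denominator is always ≥ 1 (the empty set is primitive); the zero branch is unreachable.
r : ℕ → ℕ → ℚ
r k n with numPrimitive (suc k) n
... | zero = + 0 / 1
... | suc m = + numPrimitive k n / suc m

Edge : ℕ → ℕ → ℕ → ℕ → Set
Edge lo hi a b = lo ≤ a × a ≤ hi × lo ≤ b × b ≤ hi × ¬ (a ≡ b) × ((a ∣ b) ⊎ (b ∣ a))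

-- Reach lo hi a b : b lies in the connected component of a in the divisor graph of {lo..hi}
-- (a is assumed to be a vertex)
data Reach (lo hi a : ℕ) : ℕ → Set where
  here : Reach lo hi a a
  step : ∀ {b c} → Reach lo hi a b → Edge lo hi b c → Reach lo hi a c

module Submission where

-- `extensions S L` counts the primitive subsets of L incomparable with all of S, so that
-- numPrimitive k n = ext [] (k..n] + ext [k] (k..n].  It factorises over an interleaving of two
-- mutually incomparable parts (extensions-product) and is invariant under scaling by p
-- (extensions-map).  Splitting (d..t] into the component D of d and the rest E gives
-- numPrimitive (d+1) t = X·Z, numPrimitive d t = (X+Y)·Z with X = ext [] D, Y = ext [d] D.  In
-- (p·d..p·t] the multiples of p are p·(d..t]; by hypothesis p·D is the component of p·d and
-- p·E with the non-multiples lies outside, so the same X, Y occur and both ratios are (X+Y)/X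
-- (r-scale; D and E are formed under a double negation, harmless as ℚ has decidable equality).
-- For a prime p the hypothesis passes from [D..T] to [p·D..p·T] (component-of-multiples-lift),
-- so r-scale iterates (r-scale-powers).

open import Defs
open import Data.Nat using (ℕ; zero; suc; _+_; _*_; _∸_; _^_; _≤_; _<_; s≤s; z≤n; z<s; NonZero; >-nonZero; _≟_)
open import Data.Nat.Properties
open import Data.Nat.Divisibility using (_∣_; _∣?_; divides; ∣-trans; *-monoʳ-∣; *-cancelˡ-∣; m∣m*n; ∣⇒≤)
open import Data.Nat.Primality using (Prime; prime⇒irreducible; prime⇒nonZero)
open import Data.Nat.Coprimality using (Coprime; coprime-divisor)
import Data.Integer as ℤ
open import Data.Integer.Properties using (pos-*)
open import Data.Rational using (_/_)
open import Data.Rational.Properties using (fromℚᵘ-cong) renaming (_≟_ to _≟ℚ_)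
open import Data.Rational.Unnormalised using (mkℚᵘ; *≡*)
open import Data.List as List using (List; []; _∷_; map; length; filter; upTo; applyUpTo)
open import Data.List.Properties using (length-++; filter-++; filter-≐; filter-none; length-map; filter-accept; filter-reject; map-applyUpTo; map-upTo; map-cong)
open import Data.List.Relation.Unary.All as All using (All; []; _∷_; all?)
import Data.List.Relation.Unary.All.Properties as All
open import Data.List.Relation.Unary.AllPairs using (_∷_)
open import Data.List.Relation.Ternary.Interleaving.Propositional using (Interleaving; []; consˡ; consʳ)
open import Data.List.Relation.Ternary.Interleaving.Propositional.Properties using (filter⁺)
open import Data.Bool using (true; false)
open import Data.Product using (_×_; _,_; proj₁; proj₂; swap; ∃; ∃₂)
open import Data.Sum using (_⊎_; inj₁; inj₂; [_,_]′)
open import Function using (_∘_; _∘′_)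
open import Level using (0ℓ)
open import Relation.Nullary using (¬_; Dec; yes; no; does; ¬?; contradiction)
open import Relation.Nullary.Decidable using (_×-dec_; decidable-stable; ¬¬-excluded-middle)
open import Relation.Nullary.Negation using (¬¬-Monad; ¬¬-map)
open import Relation.Unary using (Pred; Decidable)
open import Relation.Binary.PropositionalEquality

Compatible : List ℕ → List ℕ → Set
Compatible S T = Primitive T × All (λ y → All (Incomparable y) S) T

compatible? : (S : List ℕ) → Decidable (Compatible S)
compatible? S T = primitive? T ×-dec all? (λ y → all? (incomparable? y) S) T

-- The number of sublists of L compatible with S, computed by deciding whether the head of L
-- is left out or (when it is incomparable with all of S) put in.
extensions : List ℕ → List ℕ → ℕ
extensions S [] = 1
extensions S (x ∷ L) with all? (incomparable? x) S
... | yes _ = extensions S L + extensions (x ∷ S) L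
... | no _  = extensions S L

extensions-∷ : ∀ {x} S L → All (Incomparable x) S →
  extensions S (x ∷ L) ≡ extensions S L + extensions (x ∷ S) L
extensions-∷ {x} S L x#S with all? (incomparable? x) S
... | yes _   = refl
... | no x≭S = contradiction x#S x≭S

extensions-∷-blocked : ∀ {x} S L → ¬ All (Incomparable x) S → extensions S (x ∷ L) ≡ extensions S L
extensions-∷-blocked {x} S L x≭S with all? (incomparable? x) S
... | yes x#S = contradiction x#S x≭S
... | no _    = refl

-- The empty set is always compatible.
extensions-positive : ∀ S L → 1 ≤ extensions S L
extensions-positive S []      = s≤s z≤n
extensions-positive S (x ∷ L) with all? (incomparable? x) S
... | yes _ = ≤-trans (extensions-positive S L) (m≤m+n _ _)
... | no _  = extensions-positive S L

filter-map : ∀ {A B : Set} {P : Pred B 0ℓ} (P? : Decidable P) (f : A → B) xs →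
  filter P? (map f xs) ≡ map f (filter (P? ∘ f) xs)
filter-map P? f []       = refl
filter-map P? f (x ∷ xs) with does (P? (f x))
... | true  = cong (f x ∷_) (filter-map P? f xs)
... | false = filter-map P? f xs

compatible-∷⁻ : ∀ {x S T} → Compatible S (x ∷ T) → All (Incomparable x) S × Compatible (x ∷ S) T
compatible-∷⁻ ((x#T ∷ T-prim) , (x#S ∷ T#S)) = x#S , T-prim , All.zipWith (λ (x#y , y#S) → swap x#y ∷ y#S) (x#T , T#S)

compatible-∷⁺ : ∀ {x S T} → All (Incomparable x) S → Compatible (x ∷ S) T → Compatible S (x ∷ T)
compatible-∷⁺ x#S (T-prim , T#xS) with All.unzipWith (λ { (y#x ∷ y#S) → swap y#x , y#S }) T#xS
... | x#T , T#S = (x#T ∷ T-prim) , (x#S ∷ T#S)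

count-sublists-∷ : ∀ {P : Pred (List ℕ) 0ℓ} (P? : Decidable P) x L →
  length (filter P? (sublists (x ∷ L)))
    ≡ length (filter P? (sublists L)) + length (filter P? (map (x List.∷_) (sublists L)))
count-sublists-∷ P? x L = trans (cong length (filter-++ P? (sublists L) _)) (length-++ (filter P? (sublists L)))

count-with-head : ∀ {x S} X → All (Incomparable x) S →
  length (filter (compatible? S) (map (x List.∷_) X)) ≡ length (filter (compatible? (x ∷ S)) X)
count-with-head {x} {S} X x#S = begin
  length (filter (compatible? S) (map (x List.∷_) X))
    ≡⟨ cong length (filter-map (compatible? S) (x List.∷_) X) ⟩
  length (map (x List.∷_) (filter (compatible? S ∘ (x List.∷_)) X))
    ≡⟨ length-map (x List.∷_) (filter (compatible? S ∘ (x List.∷_)) X) ⟩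
  length (filter (compatible? S ∘ (x List.∷_)) X)
    ≡⟨ cong length (filter-≐ _ _ (proj₂ ∘ compatible-∷⁻ , compatible-∷⁺ x#S) X) ⟩
  length (filter (compatible? (x ∷ S)) X)
    ∎
  where open ≡-Reasoning

count-with-head-blocked : ∀ {x S} X → ¬ All (Incomparable x) S →
  length (filter (compatible? S) (map (x List.∷_) X)) ≡ 0
count-with-head-blocked {x} {S} X x≭S =
  cong length (filter-none (compatible? S) (All.map⁺ (All.universal (λ _ → x≭S ∘ proj₁ ∘ compatible-∷⁻) X)))

extensions-correct : ∀ S L → length (filter (compatible? S) (sublists L)) ≡ extensions S L
extensions-correct S []      = refl
extensions-correct S (x ∷ L) with all? (incomparable? x) S
... | yes x#S = trans (count-sublists-∷ (compatible? S) x L)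
                      (cong₂ _+_ (extensions-correct S L)
                                 (trans (count-with-head (sublists L) x#S) (extensions-correct (x ∷ S) L)))
... | no x≭S  = trans (count-sublists-∷ (compatible? S) x L)
                      (trans (cong₂ _+_ (extensions-correct S L) (count-with-head-blocked (sublists L) x≭S))
                             (+-identityʳ _))

numPrimitive≡extensions : ∀ k n → numPrimitive k n ≡ extensions [] (interval k n)
numPrimitive≡extensions k n =
  trans (cong length (filter-≐ primitive? (compatible? []) ((λ {T} prim → prim , All.universal (λ _ → []) T) , proj₁)
                               (sublists (interval k n))))
        (extensions-correct [] (interval k n))

all-interleaving⁻ : ∀ {P : Pred ℕ 0ℓ} {A B L} → Interleaving A B L → All P L → All P A × All P B
all-interleaving⁻ []        []         = [] , []
all-interleaving⁻ (consˡ i) (pa ∷ pL) with all-interleaving⁻ i pL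
... | pA , pB = pa ∷ pA , pB
all-interleaving⁻ (consʳ i) (pb ∷ pL) with all-interleaving⁻ i pL
... | pA , pB = pA , pb ∷ pB

all-interleaving⁺ : ∀ {P : Pred ℕ 0ℓ} {A B L} → Interleaving A B L → All P A → All P B → All P L
all-interleaving⁺ []        []         []         = []
all-interleaving⁺ (consˡ i) (pa ∷ pA) pB         = pa ∷ all-interleaving⁺ i pA pB
all-interleaving⁺ (consʳ i) pA         (pb ∷ pB) = pb ∷ all-interleaving⁺ i pA pB

interleaving-map : ∀ (f : ℕ → ℕ) {A B L} → Interleaving A B L → Interleaving (map f A) (map f B) (map f L)
interleaving-map f []        = []
interleaving-map f (consˡ i) = consˡ (interleaving-map f i)
interleaving-map f (consʳ i) = consʳ (interleaving-map f i)

interleaving-reassoc : ∀ {X Y M N L : List ℕ} → Interleaving X Y M → Interleaving M N L →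
  ∃ λ Z → Interleaving Y N Z × Interleaving X Z L
interleaving-reassoc []         []         = [] , [] , []
interleaving-reassoc (consˡ xy) (consˡ ml) with interleaving-reassoc xy ml
... | Z , yn , xz = Z , yn , consˡ xz
interleaving-reassoc (consʳ xy) (consˡ ml) with interleaving-reassoc xy ml
... | Z , yn , xz = _ ∷ Z , consˡ yn , consʳ xz
interleaving-reassoc xy         (consʳ ml) with interleaving-reassoc xy ml
... | Z , yn , xz = _ ∷ Z , consʳ yn , consʳ xz

partition-by : ∀ {P : Pred ℕ 0ℓ} L → All (Dec ∘ P) L →
  ∃₂ λ A B → Interleaving A B L × All P A × All (¬_ ∘ P) B
partition-by []      []             = [] , [] , [] , [] , []
partition-by (x ∷ L) (x? ∷ L?) with partition-by L L? | x?
... | A , B , A⋈B , A-P , B-¬P | yes px = x ∷ A , B , consˡ A⋈B , px ∷ A-P , B-¬P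
... | A , B , A⋈B , A-P , B-¬P | no ¬px = A , x ∷ B , consʳ A⋈B , A-P , ¬px ∷ B-¬P

¬¬-decisions : ∀ {P : Pred ℕ 0ℓ} L → ¬ ¬ All (Dec ∘ P) L
¬¬-decisions L = All.sequenceM 0ℓ ¬¬-Monad (All.universal (λ _ → ¬¬-excluded-middle) L)

-- Then a subset of L is compatible with S iff its A-part is compatible with SA and its
-- B-part with SB, so the count is a product.
module _ {Left Right : Pred ℕ 0ℓ} (separated : ∀ {a b} → Left a → Right b → Incomparable a b) where

  extensions-product : ∀ {S SA SB L A B} → Interleaving SA SB S → Interleaving A B L →
    All Left SA → All Left A → All Right SB → All Right B →
    extensions S L ≡ extensions SA A * extensions SB B
  extensions-product S⋈ [] _ _ _ _ = refl
  extensions-product {S} {SA} {SB} {u ∷ L} {u ∷ A} {B} S⋈ (consˡ L⋈) SA-l (u-l ∷ A-l) SB-r B-r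
    with all? (incomparable? u) SA
  ... | yes u#SA = begin
    extensions S (u ∷ L)                       ≡⟨ extensions-∷ S L u#S ⟩
    extensions S L + extensions (u ∷ S) L      ≡⟨ cong₂ _+_ (extensions-product S⋈ L⋈ SA-l A-l SB-r B-r)
                                                     (extensions-product (consˡ S⋈) L⋈ (u-l ∷ SA-l) A-l SB-r B-r) ⟩
    X * Z + X′ * Z                             ≡⟨ *-distribʳ-+ Z X X′ ⟨
    (X + X′) * Z                               ∎
    where
    open ≡-Reasoning
    X X′ Z : ℕ
    X = extensions SA A; X′ = extensions (u ∷ SA) A; Z = extensions SB B
    u#S : All (Incomparable u) S
    u#S = all-interleaving⁺ S⋈ u#SA (All.map (separated u-l) SB-r)
  ... | no u≭SA = begin
    extensions S (u ∷ L)                  ≡⟨ extensions-∷-blocked S L (u≭SA ∘ proj₁ ∘ all-interleaving⁻ S⋈) ⟩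
    extensions S L                        ≡⟨ extensions-product S⋈ L⋈ SA-l A-l SB-r B-r ⟩
    extensions SA A * extensions SB B     ∎
    where open ≡-Reasoning
  extensions-product {S} {SA} {SB} {v ∷ L} {A} {v ∷ B} S⋈ (consʳ L⋈) SA-l A-l SB-r (v-r ∷ B-r)
    with all? (incomparable? v) SB
  ... | yes v#SB = begin
    extensions S (v ∷ L)                       ≡⟨ extensions-∷ S L v#S ⟩
    extensions S L + extensions (v ∷ S) L      ≡⟨ cong₂ _+_ (extensions-product S⋈ L⋈ SA-l A-l SB-r B-r)
                                                     (extensions-product (consʳ S⋈) L⋈ SA-l A-l (v-r ∷ SB-r) B-r) ⟩
    X * Z + X * Z′                             ≡⟨ *-distribˡ-+ X Z Z′ ⟨
    X * (Z + Z′)                               ∎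
    where
    open ≡-Reasoning
    X Z Z′ : ℕ
    X = extensions SA A; Z = extensions SB B; Z′ = extensions (v ∷ SB) B
    v#S : All (Incomparable v) S
    v#S = all-interleaving⁺ S⋈ (All.map (λ a-l → swap (separated a-l v-r)) SA-l) v#SB
  ... | no v≭SB = begin
    extensions S (v ∷ L)                  ≡⟨ extensions-∷-blocked S L (v≭SB ∘ proj₂ ∘ all-interleaving⁻ S⋈) ⟩
    extensions S L                        ≡⟨ extensions-product S⋈ L⋈ SA-l A-l SB-r B-r ⟩
    extensions SA A * extensions SB B     ∎
    where open ≡-Reasoning

extensions-map : (f : ℕ → ℕ) → (∀ {a b} → Incomparable a b → Incomparable (f a) (f b)) →
  (∀ {a b} → Incomparable (f a) (f b) → Incomparable a b) →
  ∀ S L → extensions (map f S) (map f L) ≡ extensions S L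
extensions-map f pres reflects S []      = refl
extensions-map f pres reflects S (x ∷ L) with all? (incomparable? x) S
... | yes x#S = trans (extensions-∷ (map f S) (map f L) (All.map⁺ (All.map pres x#S)))
                      (cong₂ _+_ (extensions-map f pres reflects S L) (extensions-map f pres reflects (x ∷ S) L))
... | no x≭S  = trans (extensions-∷-blocked (map f S) (map f L) (x≭S ∘ All.map reflects ∘ All.map⁻))
                      (extensions-map f pres reflects S L)

InComponent : ℕ → ℕ → ℕ → Set
InComponent lo hi a = Reach lo hi lo a × lo ≤ a × a ≤ hi

OffComponent : ℕ → ℕ → ℕ → Set
OffComponent lo hi b = ¬ Reach lo hi lo b × lo ≤ b × b ≤ hi

-- Vertices in different components are not joined by an edge, so they are incomparable.
component-separated : ∀ {lo hi a b} → InComponent lo hi a → OffComponent lo hi b → Incomparable a b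
component-separated {a = a} {b} (reach-a , a-range) (¬reach-b , b-range) =
  (λ a∣b → ¬reach-b (step reach-a (edge (inj₁ a∣b)))) , (λ b∣a → ¬reach-b (step reach-a (edge (inj₂ b∣a))))
  where
  a≢b : ¬ a ≡ b
  a≢b refl = ¬reach-b reach-a
  edge : (a ∣ b) ⊎ (b ∣ a) → Edge _ _ a b
  edge comparable = proj₁ a-range , proj₂ a-range , proj₁ b-range , proj₂ b-range , a≢b , comparable

ComponentOfMultiples : ℕ → ℕ → ℕ → Set
ComponentOfMultiples p lo hi = ∀ m → Reach lo hi lo m → p ∣ m

module Scaling (p : ℕ) .{{_ : NonZero p}} where

  incomparable-scale : ∀ {a b} → Incomparable a b → Incomparable (p * a) (p * b)
  incomparable-scale (a∤b , b∤a) = (a∤b ∘′ *-cancelˡ-∣ p) , (b∤a ∘′ *-cancelˡ-∣ p)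

  incomparable-unscale : ∀ {a b} → Incomparable (p * a) (p * b) → Incomparable a b
  incomparable-unscale (pa∤pb , pb∤pa) = (pa∤pb ∘′ *-monoʳ-∣ p) , (pb∤pa ∘′ *-monoʳ-∣ p)

  comparable-scale : ∀ {a b} → (a ∣ b) ⊎ (b ∣ a) → (p * a ∣ p * b) ⊎ (p * b ∣ p * a)
  comparable-scale (inj₁ a∣b) = inj₁ (*-monoʳ-∣ p a∣b)
  comparable-scale (inj₂ b∣a) = inj₂ (*-monoʳ-∣ p b∣a)

  comparable-unscale : ∀ {a b} → (p * a ∣ p * b) ⊎ (p * b ∣ p * a) → (a ∣ b) ⊎ (b ∣ a)
  comparable-unscale (inj₁ pa∣pb) = inj₁ (*-cancelˡ-∣ p pa∣pb)
  comparable-unscale (inj₂ pb∣pa) = inj₂ (*-cancelˡ-∣ p pb∣pa)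

  edge-scale : ∀ {lo hi a b} → Edge lo hi a b → Edge (p * lo) (p * hi) (p * a) (p * b)
  edge-scale (lo≤a , a≤hi , lo≤b , b≤hi , a≢b , comparable) =
    *-monoʳ-≤ p lo≤a , *-monoʳ-≤ p a≤hi , *-monoʳ-≤ p lo≤b , *-monoʳ-≤ p b≤hi ,
    (λ pa≡pb → a≢b (*-cancelˡ-≡ _ _ p pa≡pb)) , comparable-scale comparable

  edge-unscale : ∀ {lo hi a b} → Edge (p * lo) (p * hi) (p * a) (p * b) → Edge lo hi a b
  edge-unscale (lo≤a , a≤hi , lo≤b , b≤hi , pa≢pb , comparable) =
    *-cancelˡ-≤ p lo≤a , *-cancelˡ-≤ p a≤hi , *-cancelˡ-≤ p lo≤b , *-cancelˡ-≤ p b≤hi ,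
    (λ a≡b → pa≢pb (cong (p *_) a≡b)) , comparable-unscale comparable

  reach-scale : ∀ {lo hi s a} → Reach lo hi s a → Reach (p * lo) (p * hi) (p * s) (p * a)
  reach-scale here            = here
  reach-scale (step path e) = step (reach-scale path) (edge-scale e)

  in-component-scale : ∀ {lo hi a} → InComponent lo hi a → InComponent (p * lo) (p * hi) (p * a)
  in-component-scale (path , lo≤a , a≤hi) = reach-scale path , *-monoʳ-≤ p lo≤a , *-monoʳ-≤ p a≤hi

  reach-unscale : ∀ {lo hi s} →
    (∀ {u c} → Reach lo hi s u → Edge (p * lo) (p * hi) (p * u) c → p ∣ c) →
    ∀ {m} → Reach (p * lo) (p * hi) (p * s) m → ∃ λ u → m ≡ p * u × Reach lo hi s u
  reach-unscale neighbours here = _ , refl , here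
  reach-unscale {lo} {hi} neighbours (step path e) with reach-unscale neighbours path
  ... | u , refl , path′ with neighbours path′ e
  ... | divides w refl =
    w , *-comm w p , step path′ (edge-unscale (subst (Edge (p * lo) (p * hi) (p * u)) (*-comm w p) e))

  component-unscale : ∀ {lo hi} → ComponentOfMultiples p (p * lo) (p * hi) →
    ∀ {m} → Reach (p * lo) (p * hi) (p * lo) m → ∃ λ u → m ≡ p * u × Reach lo hi lo u
  component-unscale multiples =
    reach-unscale (λ path e → multiples _ (step (reach-scale path) e))

  off-component-scale : ∀ {lo hi b} → ComponentOfMultiples p (p * lo) (p * hi) →
    OffComponent lo hi b → OffComponent (p * lo) (p * hi) (p * b)
  off-component-scale multiples (¬path , lo≤b , b≤hi) =
    unreachable , *-monoʳ-≤ p lo≤b , *-monoʳ-≤ p b≤hi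
    where
    unreachable : ¬ Reach _ _ _ _
    unreachable path with component-unscale multiples path
    ... | u , pb≡pu , path′ = ¬path (subst (Reach _ _ _) (sym (*-cancelˡ-≡ _ _ p pb≡pu)) path′)

coprime-to-prime : ∀ {p c} → Prime p → ¬ p ∣ c → Coprime c p
coprime-to-prime pr p∤c (i∣c , i∣p) with prime⇒irreducible pr i∣p
... | inj₁ i≡1 = i≡1
... | inj₂ refl = contradiction i∣c p∤c

-- Passing from [D..T] to [pD..pT] preserves the property that the component of the left end
-- consists of multiples of the prime p.  Every neighbour c of p·u (u in the component of D)
-- is a multiple of p: otherwise c ∣ p·u forces c ∣ u, so c is a vertex of [D..T] adjacent or
-- equal to u, hence in the component of D, hence a multiple of p after all.
component-of-multiples-lift : ∀ {p D T} → Prime p → 1 ≤ D →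
  ComponentOfMultiples p D T → ComponentOfMultiples p (p * D) (p * T)
component-of-multiples-lift {p} {D} {T} pr D≥1 multiples m path =
  multiple-of-p (reach-unscale neighbours path)
  where
  instance
    p≢0 : NonZero p
    p≢0 = prime⇒nonZero pr
  open Scaling p
  neighbours : ∀ {u c} → Reach D T D u → Edge (p * D) (p * T) (p * u) c → p ∣ c
  neighbours {u} {c} path-u (pD≤pu , pu≤pT , pD≤c , c≤pT , _ , comparable) with p ∣? c
  ... | yes p∣c = p∣c
  ... | no p∤c  = contradiction (multiples c c-reachable) p∤c
    where
    D≤u : D ≤ u
    D≤u = *-cancelˡ-≤ p pD≤pu
    u≤T : u ≤ T
    u≤T = *-cancelˡ-≤ p pu≤pT
    c∣u : c ∣ u
    c∣u = [ (λ pu∣c → contradiction (∣-trans (m∣m*n u) pu∣c) p∤c)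
          , coprime-divisor (coprime-to-prime pr p∤c) ]′ comparable
    c≤u : c ≤ u
    c≤u = ∣⇒≤ {{>-nonZero (≤-trans D≥1 D≤u)}} c∣u
    c-reachable : Reach D T D c
    c-reachable with u ≟ c
    ... | yes refl = path-u
    ... | no u≢c   = step path-u (D≤u , u≤T , ≤-trans (m≤n*m D p) pD≤c , ≤-trans c≤u u≤T , u≢c , inj₂ c∣u)
  multiple-of-p : ∀ {m} → ∃ (λ u → m ≡ p * u × Reach D T D u) → p ∣ m
  multiple-of-p (u , refl , _) = m∣m*n u

interval-cons : ∀ {k n} → k ≤ n → interval k n ≡ k ∷ interval (suc k) n
interval-cons {k} {n} k≤n rewrite +-∸-assoc 1 k≤n = cong₂ _∷_ (+-identityʳ k) (begin
  map (k +_) (applyUpTo suc (n ∸ k))   ≡⟨ map-applyUpTo suc (k +_) (n ∸ k) ⟩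
  applyUpTo (λ i → k + suc i) (n ∸ k)  ≡⟨ map-upTo (λ i → k + suc i) (n ∸ k) ⟨
  map (λ i → k + suc i) (upTo (n ∸ k)) ≡⟨ map-cong (+-suc k) (upTo (n ∸ k)) ⟩
  map (suc k +_) (upTo (n ∸ k))        ∎)
  where open ≡-Reasoning

interval-empty : ∀ {k n} → n < k → interval k n ≡ []
interval-empty n<k rewrite m≤n⇒m∸n≡0 n<k = refl

interval-range : ∀ k n → All (λ x → k ≤ x × x ≤ n) (interval k n)
interval-range k n = All.map⁺ (All.applyUpTo⁺₁ (λ i → i) (suc n ∸ k) (λ {i} i<len → m≤m+n k i , bound i<len))
  where
  bound : ∀ {i} → i < suc n ∸ k → k + i ≤ n
  bound {i} i<len = ≤-pred (begin-strict
    k + i            <⟨ +-monoʳ-< k i<len ⟩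
    k + (suc n ∸ k)  ≡⟨ m+[n∸m]≡n {k} (<⇒≤ (m∸n≢0⇒n<m (λ len≡0 → n≮0 (subst (i <_) len≡0 i<len)))) ⟩
    suc n            ∎)
    where open ≤-Reasoning

module Multiples (p : ℕ) .{{_ : NonZero p}} where

  between-multiples : ∀ {a k} → p * a < k → k < p * suc a → ¬ p ∣ k
  between-multiples {a} pa<k k<pa′ (divides w refl) = <-irrefl refl (<-≤-trans a<w (≤-pred w<1+a))
    where
    a<w : a < w
    a<w = *-cancelˡ-< p a w (subst (p * a <_) (*-comm w p) pa<k)
    w<1+a : w < suc a
    w<1+a = *-cancelˡ-< p w (suc a) (subst (_< p * suc a) (*-comm w p) k<pa′)

  -- Scanning an interval [k..p·b] of length g, with k in the block (p·a, p·(a+1)]: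
  -- the multiples of p met are p·(a+1), ..., p·b.
  multiples-from : ∀ g k a b → k + g ≡ suc (p * b) → p * a < k → k ≤ p * suc a →
    filter (p ∣?_) (interval k (p * b)) ≡ map (p *_) (interval (suc a) b)
  multiples-from zero k a b k+g≡ pa<k k≤pa′ =
    trans (cong (filter (p ∣?_)) (interval-empty pb<k)) (cong (map (p *_)) (sym (interval-empty b<1+a)))
    where
    pb<k : p * b < k
    pb<k = ≤-reflexive (sym (trans (sym (+-identityʳ k)) k+g≡))
    b<1+a : b < suc a
    b<1+a = *-cancelˡ-< p b (suc a) (<-≤-trans pb<k k≤pa′)
  multiples-from (suc g) k a b k+g≡ pa<k k≤pa′ with m≤n⇒m<n∨m≡n k≤pa′
  ... | inj₁ k<pa′ = begin
    filter (p ∣?_) (interval k (p * b))           ≡⟨ cong (filter (p ∣?_)) (interval-cons k≤pb) ⟩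
    filter (p ∣?_) (k ∷ interval (suc k) (p * b)) ≡⟨ filter-reject (p ∣?_) (between-multiples pa<k k<pa′) ⟩
    filter (p ∣?_) (interval (suc k) (p * b))     ≡⟨ multiples-from g (suc k) a b k+g′ (m<n⇒m<1+n pa<k) k<pa′ ⟩
    map (p *_) (interval (suc a) b)               ∎
    where
    open ≡-Reasoning
    k+g′ : suc k + g ≡ suc (p * b)
    k+g′ = trans (sym (+-suc k g)) k+g≡
    k≤pb : k ≤ p * b
    k≤pb = ≤-pred (subst (k <_) k+g≡ (m<m+n k z<s))
  ... | inj₂ refl = begin
    filter (p ∣?_) (interval (p * suc a) (p * b))
      ≡⟨ cong (filter (p ∣?_)) (interval-cons k≤pb) ⟩
    filter (p ∣?_) (p * suc a ∷ interval (suc (p * suc a)) (p * b))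
      ≡⟨ filter-accept (p ∣?_) (m∣m*n (suc a)) ⟩
    p * suc a ∷ filter (p ∣?_) (interval (suc (p * suc a)) (p * b))
      ≡⟨ cong (p * suc a ∷_) (multiples-from g (suc (p * suc a)) (suc a) b k+g′ ≤-refl (*-monoʳ-< p ≤-refl)) ⟩
    map (p *_) (suc a ∷ interval (suc (suc a)) b)
      ≡⟨ cong (map (p *_)) (interval-cons (*-cancelˡ-≤ p k≤pb)) ⟨
    map (p *_) (interval (suc a) b) ∎
    where
    open ≡-Reasoning
    k+g′ : suc (p * suc a) + g ≡ suc (p * b)
    k+g′ = trans (sym (+-suc (p * suc a) g)) k+g≡
    k≤pb : p * suc a ≤ p * b
    k≤pb = ≤-pred (subst (p * suc a <_) k+g≡ (m<m+n (p * suc a) z<s))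

  multiples-in-interval : ∀ {a b} → a ≤ b →
    filter (p ∣?_) (interval (suc (p * a)) (p * b)) ≡ map (p *_) (interval (suc a) b)
  multiples-in-interval {a} {b} a≤b =
    multiples-from (p * b ∸ p * a) (suc (p * a)) a b (cong suc (m+[n∸m]≡n (*-monoʳ-≤ p a≤b)))
      ≤-refl (*-monoʳ-< p ≤-refl)

  multiples-interleaving : ∀ {a b} → a ≤ b → ∃ λ N →
    Interleaving (map (p *_) (interval (suc a) b)) N (interval (suc (p * a)) (p * b)) × All (λ x → ¬ p ∣ x) N
  multiples-interleaving {a} {b} a≤b =
    filter (¬? ∘ (p ∣?_)) pJ ,
    subst (λ M → Interleaving M (filter (¬? ∘ (p ∣?_)) pJ) pJ) (multiples-in-interval a≤b) (filter⁺ (p ∣?_) pJ) ,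
    All.all-filter (¬? ∘ (p ∣?_)) pJ
    where
    pJ : List ℕ
    pJ = interval (suc (p * a)) (p * b)

/-cross : ∀ a b c d → a * suc d ≡ c * suc b → ℤ.+ a / suc b ≡ ℤ.+ c / suc d
/-cross a b c d eq = fromℚᵘ-cong {mkℚᵘ (ℤ.+ a) b} {mkℚᵘ (ℤ.+ c) d}
  (*≡* (trans (sym (pos-* a (suc d))) (trans (cong ℤ.+_ eq) (pos-* c (suc b)))))

Factorises : ℕ → ℕ → ℕ → ℕ → ℕ → Set
Factorises k n X Y Z = 1 ≤ X × 1 ≤ Z × numPrimitive (suc k) n ≡ X * Z × numPrimitive k n ≡ (X + Y) * Z

r-factorised : ∀ {k n x Y Z} → Factorises k n (suc x) Y Z → r k n ≡ ℤ.+ (suc x + Y) / suc x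
r-factorised {k} {n} {x} {Y} {suc z} (_ , _ , count₁ , count₀) with numPrimitive (suc k) n | count₁
... | _ | refl rewrite count₀ = /-cross ((suc x + Y) * suc z) (z + x * suc z) (suc x + Y) x (begin
  (suc x + Y) * suc z * suc x   ≡⟨ *-assoc (suc x + Y) (suc z) (suc x) ⟩
  (suc x + Y) * (suc z * suc x) ≡⟨ cong ((suc x + Y) *_) (*-comm (suc z) (suc x)) ⟩
  (suc x + Y) * (suc x * suc z) ∎)
  where open ≡-Reasoning

same-ratio : ∀ {k n k′ n′ X Y Z W} → Factorises k n X Y Z → Factorises k′ n′ X Y W → r k n ≡ r k′ n′
same-ratio {X = zero}  (() , _) _
same-ratio {k} {n} {k′} {n′} {X = suc x} f f′ = trans (r-factorised {k} {n} f) (sym (r-factorised {k′} {n′} f′))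

-- If (k..n] is split into the part A inside the component of k in the divisor graph of [k..n]
-- and the part B outside it, the counts factorise with X = ext [] A, Y = ext [k] A,
-- Z = ext [] B: nothing in {k} ∪ A is comparable with anything in B.
component-factorisation : ∀ {k n A B} → k ≤ n → Interleaving A B (interval (suc k) n) →
  All (InComponent k n) A → All (OffComponent k n) B →
  Factorises k n (extensions [] A) (extensions (k ∷ []) A) (extensions [] B)
component-factorisation {k} {n} {A} {B} k≤n A⋈B A-in B-off =
  extensions-positive [] A , extensions-positive [] B ,
  trans (numPrimitive≡extensions (suc k) n) (product [] []) ,
  (begin
    numPrimitive k n                         ≡⟨ numPrimitive≡extensions k n ⟩
    extensions [] (interval k n)             ≡⟨ cong (extensions []) (interval-cons k≤n) ⟩
    extensions [] (k ∷ I)                    ≡⟨⟩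
    extensions [] I + extensions (k ∷ []) I  ≡⟨ cong₂ _+_ (product [] []) (product (consˡ []) (k-in ∷ [])) ⟩
    X * Z + Y * Z                            ≡⟨ *-distribʳ-+ Z X Y ⟨
    (X + Y) * Z                              ∎)
  where
  open ≡-Reasoning
  I : List ℕ
  I = interval (suc k) n
  X Y Z : ℕ
  X = extensions [] A
  Y = extensions (k ∷ []) A
  Z = extensions [] B
  k-in : InComponent k n k
  k-in = here , ≤-refl , k≤n
  product : ∀ {S SA} → Interleaving SA [] S → All (InComponent k n) SA →
    extensions S I ≡ extensions SA A * extensions [] B
  product S⋈ SA-in = extensions-product component-separated S⋈ A⋈B SA-in A-in [] B-off

upper-interval-range : ∀ k n → All (λ x → k ≤ x × x ≤ n) (interval (suc k) n)
upper-interval-range k n = All.map (λ (k<x , x≤n) → <⇒≤ k<x , x≤n) (interval-range (suc k) n)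

-- With (d..t] split into the component part D and the rest E, the
-- interval (p·d..p·t] splits into the component part p·D and the rest: p·E together with the
-- non-multiples of p.  Both counts then factorise with the same X and Y.
r-scale : ∀ p d t .{{_ : NonZero p}} → d ≤ t → ComponentOfMultiples p (p * d) (p * t) →
  r (p * d) (p * t) ≡ r d t
r-scale p d t d≤t multiples =
  decidable-stable (r (p * d) (p * t) ≟ℚ r d t) (¬¬-map given-decisions (¬¬-decisions (interval (suc d) t)))
  where
  open Scaling p
  open Multiples p
  given-decisions : All (Dec ∘ Reach d t d) (interval (suc d) t) → r (p * d) (p * t) ≡ r d t
  given-decisions decisions with partition-by (interval (suc d) t) decisions
  ... | D , E , D⋈E , D-reach , E-¬reach
      with multiples-interleaving d≤t
  ... | N , pI⋈N , N-nonmultiples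
      with interleaving-reassoc (interleaving-map (p *_) D⋈E) pI⋈N
  ... | B , pE⋈N , pD⋈B = same-ratio {p * d} {p * t} {d} {t} scaled base
    where
    D-in : All (InComponent d t) D
    D-in = All.zip (D-reach , proj₁ (all-interleaving⁻ D⋈E (upper-interval-range d t)))
    E-off : All (OffComponent d t) E
    E-off = All.zip (E-¬reach , proj₂ (all-interleaving⁻ D⋈E (upper-interval-range d t)))
    base : Factorises d t (extensions [] D) (extensions (d ∷ []) D) (extensions [] E)
    base = component-factorisation d≤t D⋈E D-in E-off
    pD-in : All (InComponent (p * d) (p * t)) (map (p *_) D)
    pD-in = All.map⁺ (All.map in-component-scale D-in)
    B-¬reach : All (¬_ ∘ Reach (p * d) (p * t) (p * d)) B
    B-¬reach = all-interleaving⁺ pE⋈N (All.map⁺ (All.map (proj₁ ∘ off-component-scale multiples) E-off))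
                                      (All.map (λ p∤m path → p∤m (multiples _ path)) N-nonmultiples)
    B-off : All (OffComponent (p * d) (p * t)) B
    B-off = All.zip (B-¬reach , proj₂ (all-interleaving⁻ pD⋈B (upper-interval-range (p * d) (p * t))))
    scaled : Factorises (p * d) (p * t) (extensions [] D) (extensions (d ∷ []) D) (extensions [] B)
    scaled = subst₂ (λ X Y → Factorises (p * d) (p * t) X Y (extensions [] B))
               (extensions-map (p *_) incomparable-scale incomparable-unscale [] D)
               (extensions-map (p *_) incomparable-scale incomparable-unscale (d ∷ []) D)
               (component-factorisation (*-monoʳ-≤ p d≤t) pD⋈B pD-in B-off)

-- For a prime p the hypothesis propagates from [p·d..p·t] to [p^(j+1)·d..p^(j+1)·t], so
-- r-scale applies at every stage: r(p^j·d, p^j·t) = r(d, t) for all j.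
r-scale-powers : ∀ {p d t} → Prime p → 1 ≤ d → d ≤ t → ComponentOfMultiples p (p * d) (p * t) →
  ∀ j → r (p ^ j * d) (p ^ j * t) ≡ r d t
r-scale-powers {p} {d} {t} pr d≥1 d≤t multiples = ratio
  where
  instance
    p≢0 : NonZero p
    p≢0 = prime⇒nonZero pr
  components : ∀ j → ComponentOfMultiples p (p * (p ^ j * d)) (p * (p ^ j * t))
  components zero    = subst₂ (λ a b → ComponentOfMultiples p (p * a) (p * b))
                         (sym (*-identityˡ d)) (sym (*-identityˡ t)) multiples
  components (suc j) = subst₂ (λ a b → ComponentOfMultiples p (p * a) (p * b))
                         (sym (*-assoc p (p ^ j) d)) (sym (*-assoc p (p ^ j) t))
                         (component-of-multiples-lift pr p^j*d-positive (components j))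
    where
    p^j*d-positive : 1 ≤ p * (p ^ j * d)
    p^j*d-positive = ≤-trans d≥1 (≤-trans (m≤n*m d (p ^ j) {{m^n≢0 p j}}) (m≤n*m _ p))
  ratio : ∀ j → r (p ^ j * d) (p ^ j * t) ≡ r d t
  ratio zero    = cong₂ r (*-identityˡ d) (*-identityˡ t)
  ratio (suc j) = begin
    r (p ^ suc j * d) (p ^ suc j * t)       ≡⟨ cong₂ r (*-assoc p (p ^ j) d) (*-assoc p (p ^ j) t) ⟩
    r (p * (p ^ j * d)) (p * (p ^ j * t))   ≡⟨ r-scale p (p ^ j * d) (p ^ j * t) (*-monoʳ-≤ (p ^ j) d≤t) (components j) ⟩
    r (p ^ j * d) (p ^ j * t)               ≡⟨ ratio j ⟩
    r d t                                   ∎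
    where open ≡-Reasoning

mainTheorem11 : (i d t p : ℕ) → 1 ≤ i → 1 ≤ d → i * d ≤ t → t < (i + 1) * d →
    Prime p → p ≤ i →
    (∀ m → Reach (p * d) (p * t) (p * d) m → p ∣ m) →
    (r (p * d) (p * t) ≡ r d t) × (∀ j → 1 ≤ j → r (p ^ j * d) (p ^ j * t) ≡ r d t)
mainTheorem11 i d t p i≥1 d≥1 id≤t _ pr _ multiples =
  r-scale p d t d≤t multiples , λ j _ → r-scale-powers pr d≥1 d≤t multiples j
  where
  instance
    p≢0 : NonZero p
    p≢0 = prime⇒nonZero pr
  d≤t : d ≤ t
  d≤t = ≤-trans (m≤n*m d i {{>-nonZero i≥1}}) id≤t
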